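{- Let $a\ge b\ge 2$ be integers, $n=a+b+1$, and let $I=i_1\cdots i_z\vDash n$ be a composition with all parts at least $2$ such that $i_1>\Theta^-_{\overline I}(a)$. Then \[q-p=\max\{\,j\in\{0,1,\dots,z-p\}\colon |R_j|>a-i_1\,\}.\]
   Context: A composition $I=i_1\cdots i_z\vDash n$ is a sequence of positive integers with sum $n$; $\overline I=i_z\cdots i_1$; $|i_j\cdots i_k|=i_j+\dots+i_k$. $\Theta_I^-(x)=x-\max\{|i_1\cdots i_k|:0\le k\le z,\ |i_1\cdots i_k|\le x\}$. The integers $p,s,q,t$ are defined by $b+1=i_1+\dots+i_{p-1}+s=i_2+\dots+i_q+t$ with $1\le p,q\le z$, $1\le s\le i_p$, $1\le t\le i_{q+1}$, where $i_{z+1}=i_1$. For $0\le j\le z-p$, $R_j=i_{p+j+1}\cdots i_z$ (empty if $p+j=z$, with $|R_j|=0$). -}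

module Defs where

open import Data.Nat using (ℕ; zero; suc; _+_; _∸_; _≤_; _<_; _⊔_; _≤?_; _≡ᵇ_)
open import Data.List using (List; []; _∷_; take; drop; length; map; filter; foldr; upTo; reverse)
open import Data.List.Relation.Unary.All using (All)
open import Data.Nat.ListAction using (sum)
open import Data.Bool using (if_then_else_)
open import Relation.Binary.PropositionalEquality using (_≡_)

IsComposition : List ℕ → ℕ → Set
IsComposition I n = All (λ i → 1 ≤ i) I × sum I ≡ n
  where open import Data.Product using (_×_)

-- i_k (1-based); 0 outside the range 1..z.
part : List ℕ → ℕ → ℕ
part I k with drop (k ∸ 1) I
... | [] = 0
... | x ∷ _ = x

partCyc : List ℕ → ℕ → ℕ
partCyc I k = if k ≡ᵇ suc (length I) then part I 1 else part I k

prefixSum : List ℕ → ℕ → ℕ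
prefixSum I k = sum (take k I)

rev : List ℕ → List ℕ
rev = reverse

Θ⁻ : List ℕ → ℕ → ℕ
Θ⁻ I x = x ∸ foldr _⊔_ 0 (filter (_≤? x) (map (prefixSum I) (upTo (suc (length I)))))

-- |R_j| where R_j = i_{p+j+1} ⋯ i_z
∣R∣ : List ℕ → ℕ → ℕ → ℕ
∣R∣ I p j = sum (drop (p + j) I)

-- Write P k = i₁ + ⋯ + i_k and c = b + 1, so that |R_j| = n − P (p + j) and the condition
-- |R_j| > a − i₁ becomes P (p + j) < c + i₁.  The defining equations say that p is where P
-- first reaches c, and (since i₁ + ⋯ + i_q + t = c + i₁) that q is the last index with
-- P q < c + i₁.  As P is monotone, the admissible j are exactly those with p + j ≤ q, so
-- the maximum is q − p, provided j = 0 is admissible, i.e. P p < c + i₁.  That is where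
-- Θ⁻ enters: prefix sums of Ī are suffix sums of I, and among the suffix sums ≤ a the largest
-- is the one starting at p, so Θ⁻_Ī(a) = a − |i_{p+1} ⋯ i_z| = P p − c.
module Submission where

open import Defs
open import Data.Nat using (ℕ; _+_; _∸_; _≤_; _<_)
open import Data.List using (List; length; take; drop)
open import Data.Nat.ListAction using (sum)
open import Data.List.Relation.Unary.All using (All)
open import Data.Product using (_×_)
open import Relation.Binary.PropositionalEquality using (_≡_)

open import Data.Nat using (suc; zero; z≤n; s≤s; s≤s⁻¹; _≤?_; _<?_; _≡ᵇ_)
open import Data.Nat.Properties
open import Data.Nat.ListAction.Properties using (sum-++; sum-↭)
open import Data.List using ([]; _∷_; _++_; reverse; map; filter; upTo)
open import Data.List.Properties
  using (take++drop≡id; reverse-++; length-reverse; length-drop; foldr-preservesᵇ)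
open import Data.List.Relation.Binary.Permutation.Propositional.Properties using (↭-reverse)
import Data.List.Relation.Unary.All as All
open import Data.List.Relation.Unary.All.Properties using (all-filter; filter⁺; map⁺; all-upTo)
open import Data.Product using (_,_)
open import Data.Bool using (T; true; false)
open import Function using (_∘_)
open import Relation.Nullary using (contradiction; yes; no)
open import Relation.Binary.PropositionalEquality using (refl; sym; trans; cong; subst; subst₂; module ≡-Reasoning)

private variable
  A : Set

m+n≡o+p⇒m≤o⇒p≤n : ∀ {m n o p} → m + n ≡ o + p → m ≤ o → p ≤ n
m+n≡o+p⇒m≤o⇒p≤n {m} {n} {o} {p} eq m≤o = +-cancelˡ-≤ o p n (begin
  o + p ≡⟨ eq ⟨
  m + n ≤⟨ +-monoˡ-≤ n m≤o ⟩
  o + n ∎)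
  where open ≤-Reasoning

m+n≡o+p⇒m<o⇒p<n : ∀ {m n o p} → m + n ≡ o + p → m < o → p < n
m+n≡o+p⇒m<o⇒p<n {m} {n} {o} {p} eq m<o = +-cancelˡ-< o p n (begin-strict
  o + p ≡⟨ eq ⟨
  m + n <⟨ +-monoˡ-< n m<o ⟩
  o + n ∎)
  where open ≤-Reasoning

take-length-++ : (xs ys : List A) → take (length xs) (xs ++ ys) ≡ xs
take-length-++ []       ys = refl
take-length-++ (x ∷ xs) ys = cong (x ∷_) (take-length-++ xs ys)

take-reverse : ∀ {k} (xs : List A) → k ≤ length xs →
               take k (reverse xs) ≡ reverse (drop (length xs ∸ k) xs)
take-reverse {k = k} xs k≤∣xs∣ = begin
  take k (reverse xs)
    ≡⟨ cong (take k ∘ reverse) (take++drop≡id m xs) ⟨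
  take k (reverse (take m xs ++ drop m xs))
    ≡⟨ cong (take k) (reverse-++ (take m xs) (drop m xs)) ⟩
  take k (reverse (drop m xs) ++ reverse (take m xs))
    ≡⟨ cong (λ n → take n (reverse (drop m xs) ++ reverse (take m xs))) ∣suffix∣≡k ⟨
  take (length (reverse (drop m xs))) (reverse (drop m xs) ++ reverse (take m xs))
    ≡⟨ take-length-++ (reverse (drop m xs)) (reverse (take m xs)) ⟩
  reverse (drop m xs) ∎
  where
  open ≡-Reasoning
  m = length xs ∸ k
  ∣suffix∣≡k : length (reverse (drop m xs)) ≡ k
  ∣suffix∣≡k = trans (length-reverse (drop m xs))
                     (trans (length-drop m xs) (m∸[m∸n]≡n k≤∣xs∣))

sum-take-reverse : ∀ {k} xs → k ≤ length xs →
                   sum (take k (reverse xs)) ≡ sum (drop (length xs ∸ k) xs)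
sum-take-reverse {k} xs k≤∣xs∣ =
  trans (cong sum (take-reverse xs k≤∣xs∣)) (sum-↭ (↭-reverse (drop (length xs ∸ k) xs)))

sum-take+sum-drop : ∀ k xs → sum (take k xs) + sum (drop k xs) ≡ sum xs
sum-take+sum-drop k xs = trans (sym (sum-++ (take k xs) (drop k xs))) (cong sum (take++drop≡id k xs))

sum-take-suc : ∀ {k} xs → k < length xs → sum (take (suc k) xs) ≡ sum (take k xs) + part xs (suc k)
sum-take-suc {zero}  (x ∷ xs) _          = +-identityʳ x
sum-take-suc {suc k} (x ∷ xs) (s≤s k<∣xs∣) =
  trans (cong (x +_) (sum-take-suc xs k<∣xs∣)) (sym (+-assoc x _ _))

sum-take-mono : ∀ {k m} xs → k ≤ m → sum (take k xs) ≤ sum (take m xs)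
sum-take-mono {zero}          xs       _         = z≤n
sum-take-mono {suc k} {suc m} []       _         = z≤n
sum-take-mono {suc k} {suc m} (x ∷ xs) (s≤s k≤m) = +-monoʳ-≤ x (sum-take-mono xs k≤m)

sum-take-<⇒< : ∀ {k m} xs → sum (take k xs) < sum (take m xs) → k < m
sum-take-<⇒< xs Pk<Pm = ≰⇒> (<⇒≱ Pk<Pm ∘ sum-take-mono xs)

sum-drop-antitone : ∀ {k m} xs → k ≤ m → sum (drop m xs) ≤ sum (drop k xs)
sum-drop-antitone {k} {m} xs k≤m =
  m+n≡o+p⇒m≤o⇒p≤n (trans (sum-take+sum-drop k xs) (sym (sum-take+sum-drop m xs)))
                   (sum-take-mono xs k≤m)

sum-take<⇒≤ : ∀ {T q k} xs → (q < length xs → T ≤ sum (take (suc q) xs)) →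
              k ≤ length xs → sum (take k xs) < T → k ≤ q
sum-take<⇒≤ {q = q} xs T≤Pq+1 k≤∣xs∣ Pk<T with q <? length xs
... | yes q<∣xs∣ = s≤s⁻¹ (sum-take-<⇒< xs (<-≤-trans Pk<T (T≤Pq+1 q<∣xs∣)))
... | no  q≮∣xs∣ = ≤-trans k≤∣xs∣ (≮⇒≥ q≮∣xs∣)

crossing-< : ∀ {c k s} xs → c ≡ sum (take k xs) + s → 1 ≤ s → sum (take k xs) < c
crossing-< {k = k} xs c≡ 1≤s = subst (sum (take k xs) <_) (sym c≡) (m<m+n (sum (take k xs)) 1≤s)

crossing-≤ : ∀ {c k s} xs → c ≡ sum (take k xs) + s → s ≤ part xs (suc k) → k < length xs →
             c ≤ sum (take (suc k) xs)
crossing-≤ {k = k} xs c≡ s≤ k<∣xs∣ = subst₂ _≤_ (sym c≡) (sym (sum-take-suc xs k<∣xs∣))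
                                             (+-monoʳ-≤ (sum (take k xs)) s≤)

partCyc≡part : ∀ I {k} → k ≤ length I → partCyc I k ≡ part I k
partCyc≡part I {k} k≤∣I∣ with k ≡ᵇ suc (length I) in eq
... | true  = contradiction (≡ᵇ⇒≡ k (suc (length I)) (subst T (sym eq) _))
                            (<⇒≢ (s≤s k≤∣I∣))
... | false = refl

Θ⁻-reverse-≥ : ∀ I a B → (∀ k → sum (drop k I) ≤ a → sum (drop k I) ≤ B) → a ∸ B ≤ Θ⁻ (rev I) a
Θ⁻-reverse-≥ I a B bounded = ∸-monoʳ-≤ a (foldr-preservesᵇ {P = _≤ B} ⊔-lub z≤n
  (All.zipWith (λ (y≤a⇒y≤B , y≤a) → y≤a⇒y≤B y≤a)
               (filter⁺ (_≤? a) prefixes-bounded , all-filter (_≤? a) prefixes)))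
  where
  prefixes : List ℕ
  prefixes = map (prefixSum (rev I)) (upTo (suc (length (rev I))))
  suffix-bounded : ∀ {k} → k < suc (length (reverse I)) →
                   sum (take k (reverse I)) ≤ a → sum (take k (reverse I)) ≤ B
  suffix-bounded {k} k<
    rewrite sum-take-reverse I (subst (k ≤_) (length-reverse I) (s≤s⁻¹ k<)) = bounded (length I ∸ k)
  prefixes-bounded : All (λ y → y ≤ a → y ≤ B) prefixes
  prefixes-bounded = map⁺ (All.map suffix-bounded (all-upTo _))

module _ {a c : ℕ} {xs : List ℕ} (sum≡a+c : sum xs ≡ a + c) where

  take+drop≡a+c : ∀ k → sum (take k xs) + sum (drop k xs) ≡ a + c
  take+drop≡a+c k = trans (sum-take+sum-drop k xs) sum≡a+c

  drop≤a⇒c≤take : ∀ k → sum (drop k xs) ≤ a → c ≤ sum (take k xs)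
  drop≤a⇒c≤take k = m+n≡o+p⇒m≤o⇒p≤n (trans (+-comm (sum (drop k xs)) _) (take+drop≡a+c k))

  private
    rearrange : ∀ k x → a + (c + x) ≡ (sum (drop k xs) + x) + sum (take k xs)
    rearrange k x = begin
      a + (c + x)   ≡⟨ +-assoc a c x ⟨
      a + c + x     ≡⟨ cong (_+ x) (take+drop≡a+c k) ⟨
      P + D + x     ≡⟨ cong (_+ x) (+-comm P D) ⟩
      D + P + x     ≡⟨ +-assoc D P x ⟩
      D + (P + x)   ≡⟨ cong (D +_) (+-comm P x) ⟩
      D + (x + P)   ≡⟨ +-assoc D x P ⟨
      D + x + P     ∎
      where
      open ≡-Reasoning
      P = sum (take k xs)
      D = sum (drop k xs)

  a<drop+x⇒take<c+x : ∀ k {x} → a < sum (drop k xs) + x → sum (take k xs) < c + x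
  a<drop+x⇒take<c+x k {x} = m+n≡o+p⇒m<o⇒p<n (rearrange k x)

  take<c+x⇒a<drop+x : ∀ k {x} → sum (take k xs) < c + x → a < sum (drop k xs) + x
  take<c+x⇒a<drop+x k {x} =
    m+n≡o+p⇒m<o⇒p<n (trans (+-comm (sum (take k xs)) _) (trans (sym (rearrange k x)) (+-comm a (c + x))))

  Θ⁻-crossing : ∀ p {x} → sum (take p xs) < c → Θ⁻ (rev xs) a < x → sum (take (suc p) xs) < c + x
  Θ⁻-crossing p Pp<c Θ<x = a<drop+x⇒take<c+x (suc p)
    (≤-<-trans (m≤n+m∸n a D) (+-monoʳ-< D (≤-<-trans (Θ⁻-reverse-≥ xs a D maximal) Θ<x)))
    where
    D = sum (drop (suc p) xs)
    maximal : ∀ k → sum (drop k xs) ≤ a → sum (drop k xs) ≤ D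
    maximal k Dk≤a = sum-drop-antitone {suc p} {k} xs
      (sum-take-<⇒< xs (<-≤-trans Pp<c (drop≤a⇒c≤take k Dk≤a)))

proposition4p2 : (a b : ℕ) → 2 ≤ b → b ≤ a →
    (I : List ℕ) → IsComposition I (a + b + 1) → All (λ i → 2 ≤ i) I →
    Θ⁻ (rev I) a < part I 1 →
    (p s q t : ℕ) →
    1 ≤ p → p ≤ length I → 1 ≤ s → s ≤ part I p →
    b + 1 ≡ sum (take (p ∸ 1) I) + s →
    1 ≤ q → q ≤ length I → 1 ≤ t → t ≤ partCyc I (q + 1) →
    b + 1 ≡ sum (take (q ∸ 1) (drop 1 I)) + t →
    p ≤ q
    × q ∸ p ≤ length I ∸ p
    × a < ∣R∣ I p (q ∸ p) + part I 1
    × ((j : ℕ) → j ≤ length I ∸ p → a < ∣R∣ I p j + part I 1 → j ≤ q ∸ p)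
proposition4p2 a b _ _ [] _ _ _ p _ _ _ 1≤p p≤z = contradiction (≤-trans 1≤p p≤z) λ ()
proposition4p2 a b _ _ I@(x ∷ ys) (_ , sum≡) _ Θ<x (suc p') s (suc q') t
               _ p≤z 1≤s _ crossₚ _ q≤z 1≤t t≤iq+1 cross_q =
  p≤q , ∸-monoˡ-≤ p q≤z , a<R[q-p] , maximal
  where
  p = suc p'
  q = suc q'
  total : sum I ≡ a + (b + 1)
  total = trans sum≡ (+-assoc a b 1)
  cross-q : b + 1 + x ≡ sum (take q I) + t
  cross-q = trans (cong (_+ x) cross_q) (trans (+-comm _ x) (sym (+-assoc x (sum (take q' ys)) t)))
  c+x≤P[q+1] : q < length I → b + 1 + x ≤ sum (take (suc q) I)
  c+x≤P[q+1] q<z = crossing-≤ {k = q} I cross-q (subst (t ≤_) i[q+1]≡ t≤iq+1) q<z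
    where
    i[q+1]≡ : partCyc I (q + 1) ≡ part I (suc q)
    i[q+1]≡ = trans (partCyc≡part I (subst (_≤ length I) (+-comm 1 q) q<z)) (cong (part I) (+-comm q 1))
  admissible⇒≤q : ∀ k → k ≤ length I → a < sum (drop k I) + x → k ≤ q
  admissible⇒≤q k k≤z = sum-take<⇒≤ I c+x≤P[q+1] k≤z ∘ a<drop+x⇒take<c+x total k
  p≤q : p ≤ q
  p≤q = sum-take<⇒≤ I c+x≤P[q+1] p≤z
          (Θ⁻-crossing total p' (crossing-< {k = p'} I crossₚ 1≤s) Θ<x)
  a<R[q-p] : a < ∣R∣ I p (q ∸ p) + x
  a<R[q-p] = subst (λ k → a < sum (drop k I) + x) (sym (m+[n∸m]≡n p≤q))
                   (take<c+x⇒a<drop+x total q (crossing-< {k = q} I cross-q 1≤t))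
  maximal : (j : ℕ) → j ≤ length I ∸ p → a < ∣R∣ I p j + x → j ≤ q ∸ p
  maximal j j≤z-p a<Rj = m+n≤o⇒m≤o∸n j (subst (_≤ q) (+-comm p j)
    (admissible⇒≤q (p + j) (subst (_≤ length I) (+-comm j p) (m≤o∸n⇒m+n≤o j p≤z j≤z-p)) a<Rj))
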